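{- Let $G$ be a connected graph on $n$ vertices with distance squared matrix $\Delta$. Let $v$ be a vertex of degree $2$ such that removing $v$ disconnects $G$, and let $u$ and $w$ be the two neighbors of $v$. Define $\mathbf{x}\in\mathbb{R}^n$ by $x_u=x_w=1$, $x_v=-2$, and $x_i=0$ for all other vertices $i$. Then $\Delta\mathbf{x}=2\cdot\mathbf{1}$, where $\mathbf{1}$ is the all-ones vector.
   Context: For a connected graph with vertices $1,\dots,n$, the distance squared matrix $\Delta$ is the $n\times n$ matrix whose $(i,j)$ entry is $d_{ij}^2$, where $d_{ij}$ is the shortest-path distance between $i$ and $j$ (with $d_{ii}=0$). -}

module Defs where

open import Level using (0ℓ)
open import Data.Nat using (ℕ; zero; suc; _≤_)
open import Data.Integer using (ℤ; +_; -_; _+_; _*_; 0ℤ; 1ℤ)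
open import Data.Fin using (Fin; zero; suc; _≟_)
open import Data.Product using (Σ; ∃; _×_; _,_)
open import Relation.Nullary using (¬_; does)
open import Relation.Binary.PropositionalEquality using (_≡_; _≢_)
open import Data.Bool using (if_then_else_)

record Graph (n : ℕ) : Set₁ where
  field
    Adj   : Fin n → Fin n → Set
    sym   : ∀ {i j} → Adj i j → Adj j i
    irrefl : ∀ {i} → ¬ Adj i i

data Walk {n : ℕ} (R : Fin n → Fin n → Set) : Fin n → Fin n → ℕ → Set where
  here : ∀ {i} → Walk R i i 0
  step : ∀ {i j l k} → R i j → Walk R j l k → Walk R i l (suc k)

Connected : ∀ {n} → Graph n → Set
Connected G = ∀ i j → ∃ λ k → Walk (Graph.Adj G) i j k

IsDistance : ∀ {n} → Graph n → (Fin n → Fin n → ℕ) → Set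
IsDistance G d = ∀ i j → Walk (Graph.Adj G) i j (d i j)
                       × (∀ k → Walk (Graph.Adj G) i j k → d i j ≤ k)

Δ : ∀ {n} → (Fin n → Fin n → ℕ) → Fin n → Fin n → ℤ
Δ d i j = + (d i j Data.Nat.* d i j)

Degree2With : ∀ {n} → Graph n → (v u w : Fin n) → Set
Degree2With G v u w = Graph.Adj G v u × Graph.Adj G v w × u ≢ w
  × (∀ y → Graph.Adj G v y → (y ≡ u) Data.Sum.⊎ (y ≡ w))
  where import Data.Sum

DelAdj : ∀ {n} → Graph n → Fin n → Fin n → Fin n → Set
DelAdj G v a b = Graph.Adj G a b × a ≢ v × b ≢ v

IsCutVertex : ∀ {n} → Graph n → Fin n → Set
IsCutVertex G v = ∃ λ a → ∃ λ b → a ≢ v × b ≢ v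
  × ¬ (∃ λ k → Walk (DelAdj G v) a b k)

sumℤ : ∀ {n} → (Fin n → ℤ) → ℤ
sumℤ {zero} f = 0ℤ
sumℤ {suc n} f = f zero + sumℤ (λ i → f (suc i))

mulVec : ∀ {n} → (Fin n → Fin n → ℤ) → (Fin n → ℤ) → Fin n → ℤ
mulVec M x i = sumℤ (λ j → M i j * x j)

xVec : ∀ {n} → (v u w : Fin n) → Fin n → ℤ
xVec v u w j =
  if does (j ≟ v) then - (+ 2)
  else if does (j ≟ u) then 1ℤ
  else if does (j ≟ w) then 1ℤ
  else 0ℤ

-- On whichever side of the cut vertex v a vertex i lies, its distances to the
-- near neighbour, to v and to the far neighbour are t, t + 1 and t + 2, since
-- every path out of that side runs through v.  Row i of Δx is then the second
-- difference t² − 2(t + 1)² + (t + 2)² of the squares, which is 2; for i = v it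
-- is 1 + 1 − 0.
module Submission where

open import Defs
open import Data.Nat using (ℕ; zero; suc; _≤_; s≤s)
import Data.Nat as ℕ
import Data.Nat.Properties as ℕ
open import Data.Integer using (ℤ; +_; -_; _+_; _*_; 0ℤ; 1ℤ)
import Data.Integer.Properties as ℤ
open import Data.Integer.Tactic.RingSolver using (solve-∀)
open import Data.Fin using (Fin; zero; suc; _≟_)
open import Data.Product using (∃; _×_; _,_; proj₁; proj₂)
open import Data.Sum using (_⊎_; inj₁; inj₂; swap)
open import Data.Bool using (if_then_else_)
open import Relation.Nullary using (¬_; does; yes; no; contradiction)
open import Relation.Binary.PropositionalEquality

module _ {n : ℕ} {R : Fin n → Fin n → Set} where

  infixl 5 _▻_
  infixr 5 _◅◅_

  _▻_ : ∀ {a b c k} → Walk R a b k → R b c → Walk R a c (suc k)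
  here     ▻ r = step r here
  step s p ▻ r = step s (p ▻ r)

  _◅◅_ : ∀ {a b c k m} → Walk R a b k → Walk R b c m → Walk R a c (k ℕ.+ m)
  here     ◅◅ q = q
  step r p ◅◅ q = step r (p ◅◅ q)

  reverse : (∀ {a b} → R a b → R b a) → ∀ {a b k} → Walk R a b k → Walk R b a k
  reverse sym here       = here
  reverse sym (step r p) = reverse sym p ▻ sym r

  map : ∀ {S : Fin n → Fin n → Set} → (∀ {a b} → R a b → S a b)
      → ∀ {a b k} → Walk R a b k → Walk S a b k
  map f here       = here
  map f (step r p) = step (f r) (map f p)

  zero-length⇒≡ : ∀ {a b} → Walk R a b 0 → a ≡ b
  zero-length⇒≡ here = refl

sumℤ-cong : ∀ {n} {f g : Fin n → ℤ} → (∀ j → f j ≡ g j) → sumℤ f ≡ sumℤ g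
sumℤ-cong {zero}  f≗g = refl
sumℤ-cong {suc n} f≗g = cong₂ _+_ (f≗g zero) (sumℤ-cong (λ j → f≗g (suc j)))

sumℤ-zero : ∀ {n} {f : Fin n → ℤ} → (∀ j → f j ≡ 0ℤ) → sumℤ f ≡ 0ℤ
sumℤ-zero {zero}  f≗0 = refl
sumℤ-zero {suc n} f≗0 = cong₂ _+_ (f≗0 zero) (sumℤ-zero (λ j → f≗0 (suc j)))

sumℤ-+ : ∀ {n} (f g : Fin n → ℤ) → sumℤ (λ j → f j + g j) ≡ sumℤ f + sumℤ g
sumℤ-+ {zero}  f g = refl
sumℤ-+ {suc n} f g = begin
  (f zero + g zero) + sumℤ (λ j → f (suc j) + g (suc j))
    ≡⟨ cong (_+_ (f zero + g zero)) (sumℤ-+ (λ j → f (suc j)) (λ j → g (suc j))) ⟩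
  (f zero + g zero) + (sumℤ (λ j → f (suc j)) + sumℤ (λ j → g (suc j)))
    ≡⟨ interchange (f zero) (g zero) _ _ ⟩
  (f zero + sumℤ (λ j → f (suc j))) + (g zero + sumℤ (λ j → g (suc j))) ∎
  where
  open ≡-Reasoning
  interchange : ∀ a b c d → (a + b) + (c + d) ≡ (a + c) + (b + d)
  interchange = solve-∀

basis : ∀ {n} → Fin n → Fin n → ℤ
basis k j = if does (j ≟ k) then 1ℤ else 0ℤ

sumℤ-*-basis : ∀ {n} (f : Fin n → ℤ) (k : Fin n) → sumℤ (λ j → f j * basis k j) ≡ f k
sumℤ-*-basis f zero = begin
  f zero * 1ℤ + sumℤ (λ j → f (suc j) * 0ℤ)
    ≡⟨ cong₂ _+_ (ℤ.*-identityʳ (f zero)) (sumℤ-zero (λ j → ℤ.*-zeroʳ (f (suc j)))) ⟩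
  f zero + 0ℤ
    ≡⟨ ℤ.+-identityʳ (f zero) ⟩
  f zero ∎
  where open ≡-Reasoning
sumℤ-*-basis f (suc k) = begin
  f zero * 0ℤ + sumℤ (λ j → f (suc j) * basis k j)
    ≡⟨ cong₂ _+_ (ℤ.*-zeroʳ (f zero)) (sumℤ-*-basis (λ j → f (suc j)) k) ⟩
  0ℤ + f (suc k)
    ≡⟨ ℤ.+-identityˡ (f (suc k)) ⟩
  f (suc k) ∎
  where open ≡-Reasoning

xVec-basis : ∀ {n} {v u w : Fin n} → v ≢ u → v ≢ w → u ≢ w
           → ∀ j → xVec v u w j ≡ - (+ 2) * basis v j + (basis u j + basis w j)
xVec-basis {v = v} {u} {w} v≢u v≢w u≢w j with j ≟ v | j ≟ u | j ≟ w
... | yes refl | yes v≡u | _        = contradiction v≡u v≢u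
... | yes refl | no _    | yes v≡w  = contradiction v≡w v≢w
... | yes refl | no _    | no _     = refl
... | no _     | yes refl | yes u≡w = contradiction u≡w u≢w
... | no _     | yes refl | no _    = refl
... | no _     | no _     | yes refl = refl
... | no _     | no _     | no _    = refl

sumℤ-*-xVec : ∀ {n} {v u w : Fin n} → v ≢ u → v ≢ w → u ≢ w → (f : Fin n → ℤ)
            → sumℤ (λ j → f j * xVec v u w j) ≡ f v * - (+ 2) + (f u + f w)
sumℤ-*-xVec {v = v} {u} {w} v≢u v≢w u≢w f = begin
  sumℤ (λ j → f j * xVec v u w j)
    ≡⟨ sumℤ-cong (λ j → trans (cong (f j *_) (xVec-basis v≢u v≢w u≢w j))
                               (distrib (f j) (basis v j) (basis u j) (basis w j))) ⟩
  sumℤ (λ j → f j * - (+ 2) * basis v j + (f j * basis u j + f j * basis w j))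
    ≡⟨ sumℤ-+ (λ j → f j * - (+ 2) * basis v j) (λ j → f j * basis u j + f j * basis w j) ⟩
  sumℤ (λ j → f j * - (+ 2) * basis v j) + sumℤ (λ j → f j * basis u j + f j * basis w j)
    ≡⟨ cong (_+_ (sumℤ (λ j → f j * - (+ 2) * basis v j)))
            (sumℤ-+ (λ j → f j * basis u j) (λ j → f j * basis w j)) ⟩
  sumℤ (λ j → f j * - (+ 2) * basis v j)
    + (sumℤ (λ j → f j * basis u j) + sumℤ (λ j → f j * basis w j))
    ≡⟨ cong₂ _+_ (sumℤ-*-basis (λ j → f j * - (+ 2)) v)
                 (cong₂ _+_ (sumℤ-*-basis f u) (sumℤ-*-basis f w)) ⟩
  f v * - (+ 2) + (f u + f w) ∎
  where
  open ≡-Reasoning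
  distrib : ∀ x a b c → x * (- (+ 2) * a + (b + c)) ≡ x * - (+ 2) * a + (x * b + x * c)
  distrib = solve-∀

square-second-difference : ∀ t
  → + (suc t ℕ.* suc t) * - (+ 2) + (+ (t ℕ.* t) + + (suc (suc t) ℕ.* suc (suc t))) ≡ + 2
square-second-difference t = begin
  + (suc t ℕ.* suc t) * - (+ 2) + (+ (t ℕ.* t) + + (suc (suc t) ℕ.* suc (suc t)))
    ≡⟨ cong₂ (λ a b → a * - (+ 2) + b) (square 1) (cong₂ _+_ (square 0) (square 2)) ⟩
  (+ 1 + + t) * (+ 1 + + t) * - (+ 2) + ((+ 0 + + t) * (+ 0 + + t) + (+ 2 + + t) * (+ 2 + + t))
    ≡⟨ identity (+ t) ⟩
  + 2 ∎
  where
  open ≡-Reasoning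
  square : ∀ a → + ((a ℕ.+ t) ℕ.* (a ℕ.+ t)) ≡ (+ a + + t) * (+ a + + t)
  square a = trans (ℤ.pos-* (a ℕ.+ t) (a ℕ.+ t)) (cong₂ _*_ (ℤ.pos-+ a t) (ℤ.pos-+ a t))
  identity : ∀ x
    → (+ 1 + x) * (+ 1 + x) * - (+ 2) + ((+ 0 + x) * (+ 0 + x) + (+ 2 + x) * (+ 2 + x)) ≡ + 2
  identity = solve-∀

module Distance {n : ℕ} (G : Graph n) (d : Fin n → Fin n → ℕ) (isDistance : IsDistance G d) where
  open Graph G using (Adj; irrefl)

  geodesic : ∀ a b → Walk Adj a b (d a b)
  geodesic a b = proj₁ (isDistance a b)

  d-minimal : ∀ {a b k} → Walk Adj a b k → d a b ≤ k
  d-minimal {a} {b} {k} = proj₂ (isDistance a b) k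

  d-self : ∀ a → d a a ≡ 0
  d-self a = ℕ.n≤0⇒n≡0 (d-minimal here)

  d-adjacent : ∀ {a b} → Adj a b → d a b ≡ 1
  d-adjacent {a} {b} r = ℕ.≤-antisym (d-minimal (step r here)) (ℕ.n≢0⇒n>0 d≢0)
    where
    d≢0 : d a b ≢ 0
    d≢0 d≡0 = irrefl (subst (Adj a) (sym a≡b) r)
      where a≡b = zero-length⇒≡ (subst (Walk Adj a b) d≡0 (geodesic a b))

  d-step : ∀ {a b c} → Adj b c → d a c ≤ suc (d a b)
  d-step {a} {b} r = d-minimal (geodesic a b ▻ r)

module VertexDeletion {n : ℕ} (G : Graph n) (v : Fin n) where
  open Graph G renaming (sym to Adj-sym)

  infix 4 _~_

  _~_ : Fin n → Fin n → Set
  a ~ b = ∃ λ k → Walk (DelAdj G v) a b k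

  ~-sym : ∀ {a b} → a ~ b → b ~ a
  ~-sym (k , p) = k , reverse (λ (r , a≢v , b≢v) → Adj-sym r , b≢v , a≢v) p

  ~-trans : ∀ {a b c} → a ~ b → b ~ c → a ~ c
  ~-trans (_ , p) (_ , q) = _ , p ◅◅ q

  data FirstVisit (a t : Fin n) (k : ℕ) : Set where
    avoids : Walk (DelAdj G v) a t k → t ≢ v → FirstVisit a t k
    enters : ∀ {y j m} → Walk (DelAdj G v) a y j → Adj y v → Walk Adj v t m
           → suc (j ℕ.+ m) ≡ k → FirstVisit a t k

  firstVisit : ∀ {a t k} → a ≢ v → Walk Adj a t k → FirstVisit a t k
  firstVisit a≢v here = avoids here a≢v
  firstVisit a≢v (step {j = b} r p) with b ≟ v
  ... | yes refl = enters here r p refl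
  ... | no b≢v with firstVisit b≢v p
  ...   | avoids q t≢v       = avoids (step (r , a≢v , b≢v) q) t≢v
  ...   | enters q r′ p′ len = enters (step (r , a≢v , b≢v) q) r′ p′ (cong suc len)

  module _ (d : Fin n → Fin n → ℕ) (isDistance : IsDistance G d) where
    open Distance G d isDistance

    entry : ∀ {i} → i ≢ v → ∃ λ y → Adj y v × i ~ y × suc (d i y) ≤ d i v
    entry {i} i≢v with firstVisit i≢v (geodesic i v)
    ... | avoids _ v≢v = contradiction refl v≢v
    ... | enters {y} {j} {m} q r _ len =
      y , r , (j , q) , ℕ.≤-trans (s≤s (d-minimal (map proj₁ q)))
                                   (subst (suc j ≤_) len (s≤s (ℕ.m≤m+n j m)))

    d-through : ∀ {i t} → i ≢ v → ¬ i ~ t → d i v ℕ.+ d v t ≤ d i t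
    d-through {i} {t} i≢v i≁t with firstVisit i≢v (geodesic i t)
    ... | avoids q _       = contradiction (_ , q) i≁t
    ... | enters q r p len =
      subst (d i v ℕ.+ d v t ≤_) len (ℕ.+-mono-≤ (d-minimal (map proj₁ q ▻ r)) (d-minimal p))

module Degree2Vertex {n : ℕ} (G : Graph n) (d : Fin n → Fin n → ℕ) (isDistance : IsDistance G d)
  {v p q : Fin n} (v-p : Graph.Adj G v p) (v-q : Graph.Adj G v q)
  (neighbours : ∀ y → Graph.Adj G v y → y ≡ p ⊎ y ≡ q) where
  open Graph G renaming (sym to Adj-sym)
  open Distance G d isDistance
  open VertexDeletion G v

  side : ∀ {i} → i ≢ v → i ~ p ⊎ i ~ q
  side i≢v with entry d isDistance i≢v
  ... | y , y-v , i~y , _ with neighbours y (Adj-sym y-v)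
  ...   | inj₁ refl = inj₁ i~y
  ...   | inj₂ refl = inj₂ i~y

  sides-disjoint : IsCutVertex G v → ¬ p ~ q
  sides-disjoint (a , b , a≢v , b≢v , a≁b) p~q with side a≢v | side b≢v
  ... | inj₁ a~p | inj₁ b~p = a≁b (~-trans a~p (~-sym b~p))
  ... | inj₁ a~p | inj₂ b~q = a≁b (~-trans a~p (~-trans p~q (~-sym b~q)))
  ... | inj₂ a~q | inj₁ b~p = a≁b (~-trans a~q (~-trans (~-sym p~q) (~-sym b~p)))
  ... | inj₂ a~q | inj₂ b~q = a≁b (~-trans a~q (~-sym b~q))

  distances-on-side : ∀ {i} → i ≢ v → i ~ p → ¬ i ~ q
                    → d i v ≡ suc (d i p) × d i q ≡ suc (d i v)
  distances-on-side {i} i≢v i~p i≁q =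
    ℕ.≤-antisym (d-step (Adj-sym v-p)) d-v-lower , ℕ.≤-antisym (d-step v-q) d-q-lower
    where
    d-v-lower : suc (d i p) ≤ d i v
    d-v-lower with entry d isDistance i≢v
    ... | y , y-v , i~y , bound with neighbours y (Adj-sym y-v)
    ...   | inj₁ refl = bound
    ...   | inj₂ refl = contradiction i~y i≁q
    d-q-lower : suc (d i v) ≤ d i q
    d-q-lower = subst (_≤ d i q) (trans (cong (d i v ℕ.+_) (d-adjacent v-q)) (ℕ.+-comm (d i v) 1))
                      (d-through d isDistance i≢v i≁q)

  Δ-row-at-v : Δ d v v * - (+ 2) + (Δ d v p + Δ d v q) ≡ + 2
  Δ-row-at-v rewrite d-self v | d-adjacent v-p | d-adjacent v-q = refl

  Δ-row-on-side : IsCutVertex G v → ∀ {i} → i ≢ v → i ~ p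
                → Δ d i v * - (+ 2) + (Δ d i p + Δ d i q) ≡ + 2
  Δ-row-on-side cut {i} i≢v i~p
    with distances-on-side i≢v i~p (λ i~q → sides-disjoint cut (~-trans (~-sym i~p) i~q))
  ... | d-v , d-q rewrite d-q | d-v = square-second-difference (d i p)

mainTheorem3 : (n : ℕ) (G : Graph n) (d : Fin n → Fin n → ℕ) (v u w : Fin n)
    → Connected G → IsDistance G d
    → Degree2With G v u w → IsCutVertex G v
    → ∀ i → mulVec (Δ d) (xVec v u w) i ≡ + 2
mainTheorem3 n G d v u w _ isDistance (v-u , v-w , u≢w , neighbours) cut i = begin
  mulVec (Δ d) (xVec v u w) i             ≡⟨ sumℤ-*-xVec v≢u v≢w u≢w (Δ d i) ⟩
  Δ d i v * - (+ 2) + (Δ d i u + Δ d i w) ≡⟨ row ⟩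
  + 2                                     ∎
  where
  open ≡-Reasoning
  open Graph G using (irrefl)
  module U = Degree2Vertex G d isDistance v-u v-w neighbours
  module W = Degree2Vertex G d isDistance v-w v-u (λ y v-y → swap (neighbours y v-y))

  v≢u : v ≢ u
  v≢u refl = irrefl v-u
  v≢w : v ≢ w
  v≢w refl = irrefl v-w

  row : Δ d i v * - (+ 2) + (Δ d i u + Δ d i w) ≡ + 2
  row with i ≟ v
  ... | yes refl = U.Δ-row-at-v
  ... | no i≢v with U.side i≢v
  ...   | inj₁ i~u = U.Δ-row-on-side cut i≢v i~u
  ...   | inj₂ i~w = trans (cong (_+_ (Δ d i v * - (+ 2))) (ℤ.+-comm (Δ d i u) (Δ d i w)))
                           (W.Δ-row-on-side cut i≢v i~w)
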